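{- Let $\mathbb{F}_q$ be the finite field with $q$ elements, and let $A,B\subset\mathbb{F}_q$ be arbitrary nonempty subsets. Then there is an element $\xi\in\mathbb{F}_q^{*}$ such that $$|A+\xi B|\geqslant\frac{|A||B|(q-1)}{|A||B|-(|A|+|B|)+q}\quad\text{and}\quad |A-\xi B|\geqslant\frac{|A||B|(q-1)}{|A||B|-(|A|+|B|)+q}.$$
   Context: $\mathbb{F}_q^*=\mathbb{F}_q\setminus\{0\}$. For $X,Y\subset\mathbb{F}_q$ and $\xi\in\mathbb{F}_q$, $X+\xi Y=\{x+\xi y:x\in X,y\in Y\}$ and $X-\xi Y=\{x-\xi y:x\in X,y\in Y\}$. -}

module Defs where

open import Level using (0ℓ)
open import Data.Nat using (ℕ)
open import Data.Bool using (Bool)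
open import Data.Fin using (Fin)
open import Data.Fin.Subset using (Subset; _∈_)
open import Data.Fin.Subset.Properties using (_∈?_)
import Data.Fin.Properties
open import Data.Fin.Properties using (any?)
open import Data.Product using (∃; _×_; _,_)
open import Data.Vec using (tabulate)
open import Relation.Nullary using (Dec; yes; no; ¬_)
open import Relation.Nullary.Decidable using (⌊_⌋; _×-dec_)
open import Relation.Binary.PropositionalEquality using (_≡_; _≢_; trans; sym; cong)
open import Relation.Binary.Definitions using (DecidableEquality)
open import Algebra.Core using (Op₁; Op₂)
open import Algebra.Structures using (IsCommutativeRing)
open import Function.Bundles using (_↔_; Inverse)

record FiniteField : Set₁ where
  field
    Carrier : Set
    _+_ _*_ : Op₂ Carrier
    -_ : Op₁ Carrier
    0# 1# : Carrier
    isCommutativeRing : IsCommutativeRing _≡_ _+_ _*_ -_ 0# 1#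
    0≢1 : 0# ≢ 1#
    inverse : ∀ x → x ≢ 0# → ∃ λ y → x * y ≡ 1#
    q : ℕ
    enum : Fin q ↔ Carrier

  elt : Fin q → Carrier
  elt = Inverse.to enum

  _≟F_ : DecidableEquality Carrier
  x ≟F y with Data.Fin.Properties._≟_ (Inverse.from enum x) (Inverse.from enum y)
  ... | yes p = yes (trans (sym (Inverse.strictlyInverseˡ enum x))
                     (trans (cong (Inverse.to enum) p) (Inverse.strictlyInverseˡ enum y)))
  ... | no ¬p = no λ e → ¬p (cong (Inverse.from enum) e)

  -- the index set of  X + ξ Y  (for index sets X, Y ⊆ Fin q)
  sumset : Subset q → Carrier → Subset q → Subset q
  sumset X ξ Y = tabulate λ k →
    ⌊ any? (λ i → any? (λ j → (i ∈? X) ×-dec ((j ∈? Y) ×-dec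
        ((elt i + (ξ * elt j)) ≟F elt k)))) ⌋

  diffset : Subset q → Carrier → Subset q → Subset q
  diffset X ξ Y = tabulate λ k →
    ⌊ any? (λ i → any? (λ j → (i ∈? X) ×-dec ((j ∈? Y) ×-dec
        ((elt i + (- (ξ * elt j))) ≟F elt k)))) ⌋

module Submission where

-- For a map g : A × B → 𝔽_q let r(x) be the number of pairs sent to x and
-- E(g) = Σ_x r(x)², the number of pairs of pairs with equal images (the energy of g).
--  (1) Cauchy–Schwarz: Σ_x r(x) = |A||B| and r vanishes off the image, so
--      (|A||B|)² ≤ |image g| · E(g).
--  (2) For g_ξ(a, b) = a + ξb, two pairs collide for at most one ξ when b ≠ b′, for no
--      ξ ≠ 0 when exactly one coordinate agrees, and for all q − 1 values when both agree.
--      Summing over quadruples: Σ_{ξ≠0} E(g_ξ) ≤ |A||B|(|A||B| + q − |A| − |B|).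
--  (3) Some ξ ≠ 0 has (q − 1) E(g_ξ) at most this sum; with (1) this gives the bound for
--      A + ξB.  Since a − ξb = a′ − ξb′ iff a + ξb′ = a′ + ξb, the map (a, b) ↦ a − ξb has
--      the same energy, which gives the bound for A − ξB.

open import Defs
open import Algebra.Bundles using (CommutativeRing)
open import Data.Product using (∃; _×_; _,_)
open import Relation.Nullary using (¬_)
import Algebra.Properties.Ring as RingProperties
import Algebra.Solver.CommutativeMonoid as CommutativeMonoidSolver
import Relation.Binary.Reasoning.Setoid as SetoidReasoning

module LineIntersections {c ℓ} (R : CommutativeRing c ℓ) where
  open CommutativeRing R
  open RingProperties ring
    using (-‿+-comm; -‿involutive; x[y-z]≈xy-xz; x∙y⁻¹≈ε⇒x≈y; x≈y⇒x∙y⁻¹≈ε; +-cancelˡ; +-cancelʳ)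
  open CommutativeMonoidSolver +-commutativeMonoid using (solve; _⊜_; _⊕_)
  open SetoidReasoning setoid

  difference-of-sums : ∀ a x a′ x′ → (a + x) - (a′ + x′) ≈ (x - x′) - (a′ - a)
  difference-of-sums a x a′ x′ = begin
    (a + x) - (a′ + x′)          ≈⟨ +-congˡ (-‿+-comm a′ x′) ⟨
    (a + x) + (- a′ + - x′)      ≈⟨ solve 4 (λ a x a′ x′ → ((a ⊕ x) ⊕ (a′ ⊕ x′)) ⊜ ((x ⊕ x′) ⊕ (a′ ⊕ a)))
                                          refl a x (- a′) (- x′) ⟩
    (x - x′) + (- a′ + a)        ≈⟨ +-congˡ (+-congˡ (-‿involutive a)) ⟨
    (x - x′) + (- a′ + - - a)    ≈⟨ +-congˡ (-‿+-comm a′ (- a)) ⟩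
    (x - x′) - (a′ - a)          ∎

  balance : ∀ {a x a′ x′} → a + x ≈ a′ + x′ → x - x′ ≈ a′ - a
  balance {a} {x} {a′} {x′} e =
    x∙y⁻¹≈ε⇒x≈y _ _ (trans (sym (difference-of-sums a x a′ x′)) (x≈y⇒x∙y⁻¹≈ε e))

  unbalance : ∀ {a x a′ x′} → x - x′ ≈ a′ - a → a + x ≈ a′ + x′
  unbalance {a} {x} {a′} {x′} e =
    x∙y⁻¹≈ε⇒x≈y _ _ (trans (difference-of-sums a x a′ x′) (x≈y⇒x∙y⁻¹≈ε e))

  meet : ∀ {a b a′ b′ ξ} → a + ξ * b ≈ a′ + ξ * b′ → ξ * (b - b′) ≈ a′ - a
  meet {ξ = ξ} e = trans (x[y-z]≈xy-xz ξ _ _) (balance e)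

  negated-difference : ∀ u u′ → - u - - u′ ≈ u′ - u
  negated-difference u u′ = trans (+-congˡ (-‿involutive u′)) (+-comm (- u) u′)

  -- a − u = a′ − u′  iff  a + u′ = a′ + u: collisions of differences are collisions of
  -- sums with the second coordinates exchanged.
  reflect : ∀ {a u a′ u′} → a - u ≈ a′ - u′ → a + u′ ≈ a′ + u
  reflect {u = u} {u′ = u′} e = unbalance (trans (sym (negated-difference u u′)) (balance e))

  reflect⁻¹ : ∀ {a u a′ u′} → a + u′ ≈ a′ + u → a - u ≈ a′ - u′
  reflect⁻¹ {u = u} {u′ = u′} e = unbalance (trans (negated-difference u u′) (balance e))

  module WithInverses (inverse : ∀ x → ¬ x ≈ 0# → ∃ λ y → x * y ≈ 1#) where

    *-cancelˡ-nonzero : ∀ {x y z} → ¬ x ≈ 0# → x * y ≈ x * z → y ≈ z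
    *-cancelˡ-nonzero {x} {y} {z} x≉0 e with inverse x x≉0
    ... | x⁻¹ , xx⁻¹≈1 = begin
      y                 ≈⟨ *-identityˡ y ⟨
      1# * y            ≈⟨ *-congʳ (trans (*-comm x⁻¹ x) xx⁻¹≈1) ⟨
      (x⁻¹ * x) * y     ≈⟨ *-assoc x⁻¹ x y ⟩
      x⁻¹ * (x * y)     ≈⟨ *-congˡ e ⟩
      x⁻¹ * (x * z)     ≈⟨ *-assoc x⁻¹ x z ⟨
      (x⁻¹ * x) * z     ≈⟨ *-congʳ (trans (*-comm x⁻¹ x) xx⁻¹≈1) ⟩
      1# * z            ≈⟨ *-identityˡ z ⟩
      z                 ∎

    meet-unique : ∀ {a b a′ b′ ξ η} → ¬ b ≈ b′ →
      a + ξ * b ≈ a′ + ξ * b′ → a + η * b ≈ a′ + η * b′ → ξ ≈ η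
    meet-unique {a} {b} {a′} {b′} {ξ} {η} b≉b′ eξ eη =
      *-cancelˡ-nonzero (λ d≈0 → b≉b′ (x∙y⁻¹≈ε⇒x≈y b b′ d≈0)) (begin
        (b - b′) * ξ   ≈⟨ *-comm _ ξ ⟩
        ξ * (b - b′)   ≈⟨ meet eξ ⟩
        a′ - a         ≈⟨ meet eη ⟨
        η * (b - b′)   ≈⟨ *-comm η _ ⟩
        (b - b′) * η   ∎)

    meet-same-intercept : ∀ {a b b′ ξ} → ¬ ξ ≈ 0# → a + ξ * b ≈ a + ξ * b′ → b ≈ b′
    meet-same-intercept ξ≉0 e = *-cancelˡ-nonzero ξ≉0 (+-cancelˡ _ _ _ e)

    meet-same-slope : ∀ {a a′ b ξ} → a + ξ * b ≈ a′ + ξ * b → a ≈ a′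
    meet-same-slope e = +-cancelʳ _ _ _ e

open import Data.Nat using (ℕ; zero; suc; _+_; _*_; _∸_; _≤_; _≤?_; z≤n; s≤s)
open import Data.Nat.Properties
open import Data.Nat.Tactic.RingSolver using (solve-∀)
open import Data.Bool using (true; if_then_else_)
open import Data.Fin using (Fin; zero; suc)
open import Data.Fin.Properties using (any?)
  renaming (_≟_ to _≟ᶠ_; suc-injective to Fin-suc-injective; 0≢1+n to zero≢suc)
open import Data.Fin.Subset using (Subset; Nonempty; ∣_∣; _∈_; inside; outside)
open import Data.Fin.Subset.Properties using (_∈?_)
open import Data.Vec using ([]; _∷_; lookup; tabulate)
open import Data.Vec.Properties using (lookup∘tabulate; lookup⇒[]=)
open import Data.Empty using (⊥-elim)
open import Data.Sum using (inj₁; inj₂)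
open import Function using (_∘_; mk⇔; Inverse; Injection)
open import Function.Properties.Inverse using (↔⇒↣)
open import Relation.Nullary using (Dec; yes; no; does)
open import Relation.Nullary.Decidable using (⌊_⌋; _×-dec_; ¬?; does-⇔; dec-true; isYes≗does)
open import Relation.Binary.PropositionalEquality
open import Algebra.Properties.Semiring.Sum +-*-semiring
  using (sum-syntax; sum-cong-≗; ∑-distrib-+; ∑-comm; *-distribˡ-sum; *-distribʳ-sum)

𝟙[_] : ∀ {p} {P : Set p} → Dec P → ℕ
𝟙[ d ] = if does d then 1 else 0

𝟙-yes : ∀ {p} {P : Set p} (d : Dec P) → P → 𝟙[ d ] ≡ 1
𝟙-yes (yes _) _ = refl
𝟙-yes (no ¬p) p = ⊥-elim (¬p p)

𝟙-no : ∀ {p} {P : Set p} (d : Dec P) → ¬ P → 𝟙[ d ] ≡ 0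
𝟙-no (yes p) ¬p = ⊥-elim (¬p p)
𝟙-no (no _) _ = refl

𝟙-idem : ∀ {p} {P : Set p} (d : Dec P) → 𝟙[ d ] * 𝟙[ d ] ≡ 𝟙[ d ]
𝟙-idem (yes _) = refl
𝟙-idem (no _) = refl

𝟙-cong : ∀ {p q} {P : Set p} {Q : Set q} (d : Dec P) (e : Dec Q) → (P → Q) → (Q → P) →
  𝟙[ d ] ≡ 𝟙[ e ]
𝟙-cong d e to from = cong (λ b → if b then 1 else 0) (does-⇔ (mk⇔ to from) d e)

𝟙-¬-+ : ∀ {p} {P : Set p} (d : Dec P) → 𝟙[ ¬? d ] + 𝟙[ d ] ≡ 1
𝟙-¬-+ (yes _) = refl
𝟙-¬-+ (no _) = refl

𝟙-× : ∀ {p q} {P : Set p} {Q : Set q} (d : Dec P) (e : Dec Q) → 𝟙[ d ×-dec e ] ≡ 𝟙[ d ] * 𝟙[ e ]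
𝟙-× (yes _) (yes _) = refl
𝟙-× (yes _) (no _) = refl
𝟙-× (no _) _ = refl

𝟙-×-≤ : ∀ {p q} {P : Set p} {Q : Set q} (d : Dec P) (e : Dec Q) → 𝟙[ d ×-dec e ] ≤ 𝟙[ d ]
𝟙-×-≤ (yes _) (yes _) = ≤-refl
𝟙-×-≤ (yes _) (no _) = z≤n
𝟙-×-≤ (no _) _ = z≤n

∣_∣≡∑ : ∀ {n} (p : Subset n) → ∣ p ∣ ≡ ∑[ i < n ] 𝟙[ i ∈? p ]
∣ [] ∣≡∑ = refl
∣ inside ∷ p ∣≡∑ = cong suc ∣ p ∣≡∑
∣ outside ∷ p ∣≡∑ = ∣ p ∣≡∑

∑-mono : ∀ {n} {f g : Fin n → ℕ} → (∀ i → f i ≤ g i) → ∑[ i < n ] f i ≤ ∑[ i < n ] g i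
∑-mono {zero} _ = z≤n
∑-mono {suc n} f≤g = +-mono-≤ (f≤g zero) (∑-mono (f≤g ∘ suc))

∑-zero : ∀ {n} {f : Fin n → ℕ} → (∀ i → f i ≡ 0) → ∑[ i < n ] f i ≡ 0
∑-zero {zero} _ = refl
∑-zero {suc n} f≡0 = cong₂ _+_ (f≡0 zero) (∑-zero (f≡0 ∘ suc))

∑-const : ∀ n c → ∑[ i < n ] c ≡ n * c
∑-const zero c = refl
∑-const (suc n) c = cong (c +_) (∑-const n c)

term≤∑ : ∀ {n} (f : Fin n → ℕ) i → f i ≤ ∑[ k < n ] f k
term≤∑ f zero = m≤m+n _ _
term≤∑ f (suc i) = ≤-trans (term≤∑ (f ∘ suc) i) (m≤n+m _ _)

∑-delta : ∀ {n} (f : Fin n → ℕ) i → ∑[ k < n ] (f k * 𝟙[ i ≟ᶠ k ]) ≡ f i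
∑-delta {suc n} f zero = begin
  f zero * 1 + ∑[ k < n ] (f (suc k) * 𝟙[ zero ≟ᶠ suc k ])  ≡⟨ cong₂ _+_ (*-identityʳ (f zero))
                                                                (∑-zero λ k → *-zeroʳ (f (suc k))) ⟩
  f zero + 0                                               ≡⟨ +-identityʳ (f zero) ⟩
  f zero                                                   ∎
  where open ≡-Reasoning
∑-delta {suc n} f (suc i) = begin
  f zero * 0 + ∑[ k < n ] (f (suc k) * 𝟙[ suc i ≟ᶠ suc k ])  ≡⟨ cong₂ _+_ (*-zeroʳ (f zero))
                                                                 (sum-cong-≗ λ k → cong (f (suc k) *_) (shift k)) ⟩
  ∑[ k < n ] (f (suc k) * 𝟙[ i ≟ᶠ k ])                       ≡⟨ ∑-delta (f ∘ suc) i ⟩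
  f (suc i)                                                 ∎
  where
  open ≡-Reasoning
  shift : ∀ k → 𝟙[ suc i ≟ᶠ suc k ] ≡ 𝟙[ i ≟ᶠ k ]
  shift k = 𝟙-cong (suc i ≟ᶠ suc k) (i ≟ᶠ k) Fin-suc-injective (cong suc)

∑-atMostOne : ∀ {n} {P : Fin n → Set} (P? : ∀ i → Dec (P i)) → (∀ i j → P i → P j → i ≡ j) →
  ∑[ i < n ] 𝟙[ P? i ] ≤ 1
∑-atMostOne {zero} P? unique = z≤n
∑-atMostOne {suc n} P? unique with P? zero
... | yes p₀ = s≤s (≤-reflexive (∑-zero λ k → 𝟙-no (P? (suc k)) λ pk → zero≢suc (unique zero (suc k) p₀ pk)))
... | no _ = ∑-atMostOne (P? ∘ suc) (λ i j pi pj → Fin-suc-injective (unique (suc i) (suc j) pi pj))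

minimiser : ∀ {n} {P : Fin n → Set} → (∀ i → Dec (P i)) → (h : Fin n → ℕ) → ∃ P →
  ∃ λ l → P l × (∀ k → P k → h l ≤ h k)
minimiser {suc n} {P} P? h (k , pk) with any? (P? ∘ suc)
... | no noneAfter = zero , first k pk , λ { zero _ → ≤-refl ; (suc k) pk → ⊥-elim (noneAfter (k , pk)) }
  where
  first : ∀ k → P k → P zero
  first zero pk = pk
  first (suc k) pk = ⊥-elim (noneAfter (k , pk))
... | yes someAfter with minimiser (P? ∘ suc) (h ∘ suc) someAfter | P? zero
...   | l , pl , min | no ¬p₀ = suc l , pl , λ { zero p₀ → ⊥-elim (¬p₀ p₀) ; (suc k) pk → min k pk }
...   | l , pl , min | yes p₀ with h (suc l) ≤? h zero
...     | yes le = suc l , pl , λ { zero _ → le ; (suc k) pk → min k pk }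
...     | no gt = zero , p₀ , λ { zero _ → ≤-refl ; (suc k) pk → ≤-trans (<⇒≤ (≰⇒> gt)) (min k pk) }

below-average : ∀ {n} {P : Fin n → Set} (P? : ∀ i → Dec (P i)) (h : Fin n → ℕ) → ∃ P →
  ∃ λ l → P l × (∑[ k < n ] 𝟙[ P? k ]) * h l ≤ ∑[ k < n ] (𝟙[ P? k ] * h k)
below-average {n} P? h inhabited with minimiser P? h inhabited
... | l , pl , min = l , pl , (begin
  (∑[ k < n ] 𝟙[ P? k ]) * h l  ≡⟨ *-distribʳ-sum (h l) (λ k → 𝟙[ P? k ]) ⟩
  ∑[ k < n ] (𝟙[ P? k ] * h l)  ≤⟨ ∑-mono pointwise ⟩
  ∑[ k < n ] (𝟙[ P? k ] * h k)  ∎)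
  where
  open ≤-Reasoning
  pointwise : ∀ k → 𝟙[ P? k ] * h l ≤ 𝟙[ P? k ] * h k
  pointwise k with P? k
  ... | yes pk = *-monoʳ-≤ 1 (min k pk)
  ... | no _ = z≤n

2xy≤x²+y² : ∀ x y → x * y + x * y ≤ x * x + y * y
2xy≤x²+y² x y with ≤-total x y
... | inj₁ x≤y with m≤n⇒∃[o]m+o≡n x≤y
...   | d , refl = ≤-trans (m≤m+n _ (d * d)) (≤-reflexive (expand x d))
  where
  expand : ∀ x d → x * (x + d) + x * (x + d) + d * d ≡ x * x + (x + d) * (x + d)
  expand = solve-∀
2xy≤x²+y² x y | inj₂ y≤x with m≤n⇒∃[o]m+o≡n y≤x
...   | d , refl = ≤-trans (m≤m+n _ (d * d)) (≤-reflexive (expand y d))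
  where
  expand : ∀ y d → (y + d) * y + (y + d) * y + d * d ≡ (y + d) * (y + d) + y * y
  expand = solve-∀

amgm-on : ∀ {p} {P : Set p} (d : Dec P) x y → (¬ P → y ≡ 0) → x * y + x * y ≤ 𝟙[ d ] * (x * x) + y * y
amgm-on (yes _) x y _ = ≤-trans (2xy≤x²+y² x y) (≤-reflexive (cong (_+ y * y) (sym (+-identityʳ (x * x)))))
amgm-on (no ¬p) x y vanish rewrite vanish ¬p | *-zeroʳ x = z≤n

cs-linear : ∀ {n} {P : Fin n → Set} (P? : ∀ i → Dec (P i)) (f : Fin n → ℕ) → (∀ k → ¬ P k → f k ≡ 0) →
  ∀ x → x * ∑[ k < n ] f k + x * ∑[ k < n ] f k ≤ (∑[ k < n ] 𝟙[ P? k ]) * (x * x) + ∑[ k < n ] (f k * f k)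
cs-linear {zero} P? f vanish x = ≤-reflexive (cong₂ _+_ (*-zeroʳ x) (*-zeroʳ x))
cs-linear {suc n} P? f vanish x = begin
  x * (f₀ + F) + x * (f₀ + F)                   ≡⟨ split x f₀ F ⟩
  (x * f₀ + x * f₀) + (x * F + x * F)           ≤⟨ +-mono-≤ (amgm-on (P? zero) x f₀ (vanish zero))
                                                            (cs-linear (P? ∘ suc) (f ∘ suc) (vanish ∘ suc) x) ⟩
  (s * (x * x) + f₀ * f₀) + (C * (x * x) + Q)   ≡⟨ regroup s C x f₀ Q ⟩
  (s + C) * (x * x) + (f₀ * f₀ + Q)             ∎
  where
  open ≤-Reasoning
  f₀ s F C Q : ℕ
  f₀ = f zero
  s = 𝟙[ P? zero ]
  F = ∑[ k < n ] f (suc k)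
  C = ∑[ k < n ] 𝟙[ P? (suc k) ]
  Q = ∑[ k < n ] (f (suc k) * f (suc k))
  split : ∀ x a F → x * (a + F) + x * (a + F) ≡ (x * a + x * a) + (x * F + x * F)
  split = solve-∀
  regroup : ∀ s C x a Q → (s * (x * x) + a * a) + (C * (x * x) + Q) ≡ (s + C) * (x * x) + (a * a + Q)
  regroup = solve-∀

cauchy-schwarz : ∀ {n} {P : Fin n → Set} (P? : ∀ i → Dec (P i)) (f : Fin n → ℕ) → (∀ k → ¬ P k → f k ≡ 0) →
  (∑[ k < n ] f k) * (∑[ k < n ] f k) ≤ (∑[ k < n ] 𝟙[ P? k ]) * ∑[ k < n ] (f k * f k)
cauchy-schwarz {zero} P? f vanish = z≤n
cauchy-schwarz {suc n} P? f vanish with P? zero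
... | yes _ = begin
  (f₀ + F) * (f₀ + F)                       ≡⟨ expand f₀ F ⟩
  f₀ * f₀ + (f₀ * F + f₀ * F) + F * F       ≤⟨ +-mono-≤ (+-monoʳ-≤ (f₀ * f₀) cross-terms) squares ⟩
  f₀ * f₀ + (C * (f₀ * f₀) + Q) + C * Q     ≡⟨ factor f₀ C Q ⟩
  (1 + C) * (f₀ * f₀ + Q)                   ∎
  where
  open ≤-Reasoning
  f₀ F C Q : ℕ
  f₀ = f zero
  F = ∑[ k < n ] f (suc k)
  C = ∑[ k < n ] 𝟙[ P? (suc k) ]
  Q = ∑[ k < n ] (f (suc k) * f (suc k))
  cross-terms : f₀ * F + f₀ * F ≤ C * (f₀ * f₀) + Q
  cross-terms = cs-linear (P? ∘ suc) (f ∘ suc) (vanish ∘ suc) f₀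
  squares : F * F ≤ C * Q
  squares = cauchy-schwarz (P? ∘ suc) (f ∘ suc) (vanish ∘ suc)
  expand : ∀ a F → (a + F) * (a + F) ≡ a * a + (a * F + a * F) + F * F
  expand = solve-∀
  factor : ∀ a C Q → a * a + (C * (a * a) + Q) + C * Q ≡ (1 + C) * (a * a + Q)
  factor = solve-∀
... | no ¬p₀ rewrite vanish zero ¬p₀ = cauchy-schwarz (P? ∘ suc) (f ∘ suc) (vanish ∘ suc)

∑² : ∀ {n} → (Fin n → Fin n → ℕ) → ℕ
∑² {n} f = ∑[ i < n ] ∑[ j < n ] f i j

∑⁴ : ∀ {n} → (Fin n → Fin n → Fin n → Fin n → ℕ) → ℕ
∑⁴ H = ∑² λ i j → ∑² λ i′ j′ → H i j i′ j′

module _ {n : ℕ} where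
  ∑²-cong : {f g : Fin n → Fin n → ℕ} → (∀ i j → f i j ≡ g i j) → ∑² f ≡ ∑² g
  ∑²-cong f≡g = sum-cong-≗ λ i → sum-cong-≗ (f≡g i)

  ∑²-zero : {f : Fin n → Fin n → ℕ} → (∀ i j → f i j ≡ 0) → ∑² f ≡ 0
  ∑²-zero f≡0 = ∑-zero λ i → ∑-zero (f≡0 i)

  ∑²-mono : {f g : Fin n → Fin n → ℕ} → (∀ i j → f i j ≤ g i j) → ∑² f ≤ ∑² g
  ∑²-mono f≤g = ∑-mono λ i → ∑-mono (f≤g i)

  ∑²-distrib-+ : (f g : Fin n → Fin n → ℕ) → ∑² (λ i j → f i j + g i j) ≡ ∑² f + ∑² g
  ∑²-distrib-+ f g = trans (sum-cong-≗ λ i → ∑-distrib-+ (f i) (g i))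
                           (∑-distrib-+ (λ i → ∑[ j < n ] f i j) (λ i → ∑[ j < n ] g i j))

  *-distribˡ-∑² : ∀ c (f : Fin n → Fin n → ℕ) → c * ∑² f ≡ ∑² (λ i j → c * f i j)
  *-distribˡ-∑² c f = trans (*-distribˡ-sum c (λ i → ∑[ j < n ] f i j)) (sum-cong-≗ λ i → *-distribˡ-sum c (f i))

  ∑-∑²-comm : ∀ {m} (f : Fin m → Fin n → Fin n → ℕ) → ∑[ k < m ] ∑² (f k) ≡ ∑² (λ i j → ∑[ k < m ] f k i j)
  ∑-∑²-comm f = trans (∑-comm λ k i → ∑[ j < n ] f k i j) (sum-cong-≗ λ i → ∑-comm λ k j → f k i j)

  ∑²-outer : (u v : Fin n → ℕ) → ∑² (λ i j → u i * v j) ≡ ∑[ i < n ] u i * ∑[ j < n ] v j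
  ∑²-outer u v = sym (trans (*-distribʳ-sum (∑[ j < n ] v j) u) (sum-cong-≗ λ i → *-distribˡ-sum (u i) v))

  ∑²-diagonal : (u : Fin n → ℕ) → (∀ i → u i * u i ≡ u i) →
    ∑² (λ i i′ → u i * u i′ * 𝟙[ i ≟ᶠ i′ ]) ≡ ∑[ i < n ] u i
  ∑²-diagonal u idem = sum-cong-≗ λ i → begin
    ∑[ i′ < n ] (u i * u i′ * 𝟙[ i ≟ᶠ i′ ])    ≡⟨ sum-cong-≗ (λ i′ → *-assoc (u i) (u i′) 𝟙[ i ≟ᶠ i′ ]) ⟩
    ∑[ i′ < n ] (u i * (u i′ * 𝟙[ i ≟ᶠ i′ ]))  ≡⟨ *-distribˡ-sum (u i) (λ i′ → u i′ * 𝟙[ i ≟ᶠ i′ ]) ⟨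
    u i * ∑[ i′ < n ] (u i′ * 𝟙[ i ≟ᶠ i′ ])    ≡⟨ cong (u i *_) (∑-delta u i) ⟩
    u i * u i                                  ≡⟨ idem i ⟩
    u i                                        ∎
    where open ≡-Reasoning

  ∑²-product : (f g : Fin n → Fin n → ℕ) → ∑² f * ∑² g ≡ ∑⁴ (λ i j i′ j′ → f i j * g i′ j′)
  ∑²-product f g = trans (*-distribʳ-sum (∑² g) (λ i → ∑[ j < n ] f i j)) (sum-cong-≗ λ i →
    trans (*-distribʳ-sum (∑² g) (f i)) (sum-cong-≗ λ j → *-distribˡ-∑² (f i j) g))

  ∑⁴-cong : {G H : Fin n → Fin n → Fin n → Fin n → ℕ} → (∀ i j i′ j′ → G i j i′ j′ ≡ H i j i′ j′) →
    ∑⁴ G ≡ ∑⁴ H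
  ∑⁴-cong G≡H = ∑²-cong λ i j → ∑²-cong (G≡H i j)

  ∑⁴-mono : {G H : Fin n → Fin n → Fin n → Fin n → ℕ} → (∀ i j i′ j′ → G i j i′ j′ ≤ H i j i′ j′) →
    ∑⁴ G ≤ ∑⁴ H
  ∑⁴-mono G≤H = ∑²-mono λ i j → ∑²-mono (G≤H i j)

  ∑⁴-distrib-+ : (G H : Fin n → Fin n → Fin n → Fin n → ℕ) →
    ∑⁴ (λ i j i′ j′ → G i j i′ j′ + H i j i′ j′) ≡ ∑⁴ G + ∑⁴ H
  ∑⁴-distrib-+ G H = trans (∑²-cong λ i j → ∑²-distrib-+ (G i j) (H i j)) (∑²-distrib-+ _ _)

  *-distribˡ-∑⁴ : ∀ c (H : Fin n → Fin n → Fin n → Fin n → ℕ) → c * ∑⁴ H ≡ ∑⁴ (λ i j i′ j′ → c * H i j i′ j′)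
  *-distribˡ-∑⁴ c H = trans (*-distribˡ-∑² c _) (∑²-cong λ i j → *-distribˡ-∑² c (H i j))

  ∑-∑⁴-comm : ∀ {m} (H : Fin m → Fin n → Fin n → Fin n → Fin n → ℕ) →
    ∑[ k < m ] ∑⁴ (H k) ≡ ∑⁴ (λ i j i′ j′ → ∑[ k < m ] H k i j i′ j′)
  ∑-∑⁴-comm H = trans (∑-∑²-comm λ k i j → ∑² (H k i j)) (∑²-cong λ i j → ∑-∑²-comm λ k → H k i j)

  ∑⁴-middle : (H : Fin n → Fin n → Fin n → Fin n → ℕ) →
    ∑⁴ H ≡ ∑[ i < n ] ∑[ i′ < n ] ∑[ j < n ] ∑[ j′ < n ] H i j i′ j′
  ∑⁴-middle H = sum-cong-≗ λ i → ∑-comm λ j i′ → ∑[ j′ < n ] H i j i′ j′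

  ∑⁴-separate : (f g : Fin n → Fin n → ℕ) → ∑⁴ (λ i j i′ j′ → f i i′ * g j j′) ≡ ∑² f * ∑² g
  ∑⁴-separate f g = trans (∑⁴-middle _) (sym (∑²-product f g))

  ∑⁴-swap : (H : Fin n → Fin n → Fin n → Fin n → ℕ) → ∑⁴ (λ i j i′ j′ → H i j′ i′ j) ≡ ∑⁴ H
  ∑⁴-swap H = begin
    ∑⁴ (λ i j i′ j′ → H i j′ i′ j)                               ≡⟨ ∑⁴-middle _ ⟩
    ∑[ i < n ] ∑[ i′ < n ] ∑[ j < n ] ∑[ j′ < n ] H i j′ i′ j   ≡⟨ sum-cong-≗ (λ i → sum-cong-≗ λ i′ →
                                                                     ∑-comm λ j j′ → H i j′ i′ j) ⟩
    ∑[ i < n ] ∑[ i′ < n ] ∑[ j′ < n ] ∑[ j < n ] H i j′ i′ j   ≡⟨ ∑⁴-middle H ⟨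
    ∑⁴ H                                                         ∎
    where open ≡-Reasoning

collision-budget : ∀ m n q D → 1 ≤ m → 1 ≤ n → 1 ≤ q →
  D + m * (n * n) + (m * m) * n ≤ q * (m * n) + (m * m) * (n * n) → D ≤ m * n * ((m * n + q) ∸ (m + n))
collision-budget (suc m) (suc n) (suc q) D _ _ _ bound = begin
  D                                            ≤⟨ +-cancelʳ-≤ X D (P * K) D+X≤PK+X ⟩
  P * K                                        ≡⟨ cong (P *_) (m+n∸n≡m K (suc m + suc n)) ⟨
  P * (K + (suc m + suc n) ∸ (suc m + suc n))  ≡⟨ cong (λ t → P * (t ∸ (suc m + suc n))) (K+m+n m n q) ⟩
  P * ((P + suc q) ∸ (suc m + suc n))          ∎
  where
  open ≤-Reasoning
  P K X : ℕ
  P = suc m * suc n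
  K = m * n + q
  X = suc m * (suc n * suc n) + (suc m * suc m) * suc n
  K+m+n : ∀ m n q → (m * n + q) + (suc m + suc n) ≡ suc m * suc n + suc q
  K+m+n = solve-∀
  PK+X : ∀ m n q → suc q * (suc m * suc n) + (suc m * suc m) * (suc n * suc n)
                   ≡ suc m * suc n * (m * n + q) + (suc m * (suc n * suc n) + (suc m * suc m) * suc n)
  PK+X = solve-∀
  D+X≤PK+X : D + X ≤ P * K + X
  D+X≤PK+X = begin
    D + X                                                   ≡⟨ +-assoc D _ _ ⟨
    D + suc m * (suc n * suc n) + (suc m * suc m) * suc n   ≤⟨ bound ⟩
    suc q * P + (suc m * suc m) * (suc n * suc n)           ≡⟨ PK+X m n q ⟩
    P * K + X                                               ∎

-- The final combination: from P² ≤ S·E, r·E ≤ D and D ≤ P·K conclude P·r ≤ S·K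
-- (S the size of the sumset, E its energy, D the total energy, r = q − 1).
dilate-bound : ∀ P S E D K r → P * P ≤ S * E → r * E ≤ D → D ≤ P * K → P * r ≤ S * K
dilate-bound zero S E D K r _ _ _ = z≤n
dilate-bound P@(suc _) S E D K r P²≤SE rE≤D D≤PK = *-cancelʳ-≤ (P * r) (S * K) P (begin
  P * r * P      ≡⟨ rearrange P r ⟩
  r * (P * P)    ≤⟨ *-monoʳ-≤ r P²≤SE ⟩
  r * (S * E)    ≡⟨ swap r S E ⟩
  S * (r * E)    ≤⟨ *-monoʳ-≤ S rE≤D ⟩
  S * D          ≤⟨ *-monoʳ-≤ S D≤PK ⟩
  S * (P * K)    ≡⟨ swap S P K ⟩
  P * (S * K)    ≡⟨ *-comm P (S * K) ⟩
  S * K * P      ∎)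
  where
  open ≤-Reasoning
  rearrange : ∀ P r → P * r * P ≡ r * (P * P)
  rearrange = solve-∀
  swap : ∀ x y z → x * (y * z) ≡ y * (x * z)
  swap = solve-∀

module Enumeration (F : FiniteField) where
  open FiniteField F using (Carrier; q; enum; elt; _≟F_)

  index : Carrier → Fin q
  index = Inverse.from enum

  elt-injective : ∀ {i j} → elt i ≡ elt j → i ≡ j
  elt-injective = Injection.injective (↔⇒↣ enum)

  ∑-elt : ∀ x → ∑[ k < q ] 𝟙[ x ≟F elt k ] ≡ 1
  ∑-elt x = begin
    ∑[ k < q ] 𝟙[ x ≟F elt k ]            ≡⟨ sum-cong-≗ (λ k → 𝟙-cong (x ≟F elt k) (index x ≟ᶠ k) to from) ⟩
    ∑[ k < q ] 𝟙[ index x ≟ᶠ k ]          ≡⟨ sum-cong-≗ (λ k → *-identityˡ 𝟙[ index x ≟ᶠ k ]) ⟨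
    ∑[ k < q ] (1 * 𝟙[ index x ≟ᶠ k ])    ≡⟨ ∑-delta (λ _ → 1) (index x) ⟩
    1                                     ∎
    where
    open ≡-Reasoning
    to : ∀ {k} → x ≡ elt k → index x ≡ k
    to refl = Inverse.strictlyInverseʳ enum _
    from : ∀ {k} → index x ≡ k → x ≡ elt k
    from refl = sym (Inverse.strictlyInverseˡ enum x)

  ∑-elt² : ∀ x y → ∑[ k < q ] (𝟙[ x ≟F elt k ] * 𝟙[ y ≟F elt k ]) ≡ 𝟙[ x ≟F y ]
  ∑-elt² x y with x ≟F y
  ... | yes refl = trans (sum-cong-≗ λ k → 𝟙-idem (x ≟F elt k)) (∑-elt x)
  ... | no x≢y = ∑-zero never-both
    where
    never-both : ∀ k → 𝟙[ x ≟F elt k ] * 𝟙[ y ≟F elt k ] ≡ 0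
    never-both k with x ≟F elt k | y ≟F elt k
    ... | yes x≡k | yes y≡k = ⊥-elim (x≢y (trans x≡k (sym y≡k)))
    ... | yes _ | no _ = refl
    ... | no _ | _ = refl

module Energy (F : FiniteField) (A B : Subset (FiniteField.q F)) where
  open FiniteField F using (Carrier; q; elt; _≟F_)
  open Enumeration F

  a b : Fin q → ℕ
  a i = 𝟙[ i ∈? A ]
  b j = 𝟙[ j ∈? B ]

  #A #B : ℕ
  #A = ∑[ i < q ] a i
  #B = ∑[ j < q ] b j

  w : Fin q → Fin q → ℕ
  w i j = a i * b j

  W : Fin q → Fin q → Fin q → Fin q → ℕ
  W i j i′ j′ = w i j * w i′ j′

  module _ (g : Fin q → Fin q → Carrier) where

    image : Subset q
    image = tabulate λ k →
      ⌊ any? (λ i → any? (λ j → (i ∈? A) ×-dec ((j ∈? B) ×-dec (g i j ≟F elt k)))) ⌋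

    hit : Fin q → Fin q → Fin q → ℕ
    hit k i j = w i j * 𝟙[ g i j ≟F elt k ]

    representations : Fin q → ℕ
    representations k = ∑² (hit k)

    energy : ℕ
    energy = ∑⁴ λ i j i′ j′ → W i j i′ j′ * 𝟙[ g i j ≟F g i′ j′ ]

    ∑-representations : ∑[ k < q ] representations k ≡ #A * #B
    ∑-representations = begin
      ∑[ k < q ] representations k                          ≡⟨ ∑-∑²-comm hit ⟩
      ∑² (λ i j → ∑[ k < q ] hit k i j)                     ≡⟨ ∑²-cong pull-out ⟨
      ∑² (λ i j → w i j * ∑[ k < q ] 𝟙[ g i j ≟F elt k ])   ≡⟨ ∑²-cong counted-once ⟩
      ∑² w                                                  ≡⟨ ∑²-outer a b ⟩
      #A * #B                                               ∎
      where
      open ≡-Reasoning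
      pull-out : ∀ i j → w i j * ∑[ k < q ] 𝟙[ g i j ≟F elt k ] ≡ ∑[ k < q ] hit k i j
      pull-out i j = *-distribˡ-sum (w i j) (λ k → 𝟙[ g i j ≟F elt k ])
      counted-once : ∀ i j → w i j * ∑[ k < q ] 𝟙[ g i j ≟F elt k ] ≡ w i j
      counted-once i j = trans (cong (w i j *_) (∑-elt (g i j))) (*-identityʳ (w i j))

    ∑-representations² : ∑[ k < q ] (representations k * representations k) ≡ energy
    ∑-representations² = begin
      ∑[ k < q ] (representations k * representations k)
        ≡⟨ sum-cong-≗ (λ k → ∑²-product (hit k) (hit k)) ⟩
      ∑[ k < q ] ∑⁴ (λ i j i′ j′ → hit k i j * hit k i′ j′)
        ≡⟨ ∑-∑⁴-comm (λ k i j i′ j′ → hit k i j * hit k i′ j′) ⟩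
      ∑⁴ (λ i j i′ j′ → ∑[ k < q ] (hit k i j * hit k i′ j′))
        ≡⟨ ∑⁴-cong (λ i j i′ j′ → sum-cong-≗ λ k →
             regroup (w i j) (w i′ j′) 𝟙[ g i j ≟F elt k ] 𝟙[ g i′ j′ ≟F elt k ]) ⟩
      ∑⁴ (λ i j i′ j′ → ∑[ k < q ] (W i j i′ j′ * (𝟙[ g i j ≟F elt k ] * 𝟙[ g i′ j′ ≟F elt k ])))
        ≡⟨ ∑⁴-cong (λ i j i′ j′ → trans (cong (W i j i′ j′ *_) (sym (∑-elt² (g i j) (g i′ j′))))
             (*-distribˡ-sum (W i j i′ j′) (λ k → 𝟙[ g i j ≟F elt k ] * 𝟙[ g i′ j′ ≟F elt k ]))) ⟨
      energy ∎
      where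
      open ≡-Reasoning
      regroup : ∀ x y u v → x * u * (y * v) ≡ x * y * (u * v)
      regroup = solve-∀

    image-member : ∀ {i j k} → i ∈ A → j ∈ B → g i j ≡ elt k → k ∈ image
    image-member {i} {j} {k} i∈A j∈B gij≡k = lookup⇒[]= k image (begin
      lookup image k    ≡⟨ lookup∘tabulate _ k ⟩
      ⌊ some-pair? ⌋    ≡⟨ isYes≗does some-pair? ⟩
      does some-pair?   ≡⟨ dec-true some-pair? (i , j , i∈A , j∈B , gij≡k) ⟩
      true              ∎)
      where
      open ≡-Reasoning
      some-pair? : Dec (∃ λ i → ∃ λ j → i ∈ A × j ∈ B × g i j ≡ elt k)
      some-pair? = any? λ i → any? λ j → (i ∈? A) ×-dec ((j ∈? B) ×-dec (g i j ≟F elt k))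

    representations-outside-image : ∀ k → ¬ k ∈ image → representations k ≡ 0
    representations-outside-image k k∉image = ∑²-zero no-hit
      where
      hit? : ∀ i j → Dec (i ∈ A × j ∈ B × g i j ≡ elt k)
      hit? i j = (i ∈? A) ×-dec ((j ∈? B) ×-dec (g i j ≟F elt k))
      no-hit : ∀ i j → hit k i j ≡ 0
      no-hit i j = begin
        a i * b j * 𝟙[ g i j ≟F elt k ]               ≡⟨ *-assoc (a i) (b j) _ ⟩
        a i * (b j * 𝟙[ g i j ≟F elt k ])             ≡⟨ cong (a i *_) (𝟙-× (j ∈? B) (g i j ≟F elt k)) ⟨
        a i * 𝟙[ (j ∈? B) ×-dec (g i j ≟F elt k) ]    ≡⟨ 𝟙-× (i ∈? A) ((j ∈? B) ×-dec (g i j ≟F elt k)) ⟨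
        𝟙[ hit? i j ]                                 ≡⟨ 𝟙-no (hit? i j) (λ (i∈A , j∈B , e) →
                                                                 k∉image (image-member i∈A j∈B e)) ⟩
        0                                             ∎
        where open ≡-Reasoning

    cauchy-schwarz-image : (#A * #B) * (#A * #B) ≤ ∣ image ∣ * energy
    cauchy-schwarz-image = subst₂ _≤_
      (cong₂ _*_ ∑-representations ∑-representations)
      (cong₂ _*_ (sym ∣ image ∣≡∑) ∑-representations²)
      (cauchy-schwarz (_∈? image) representations representations-outside-image)

  open FiniteField F using (0#; 1#; 0≢1; inverse; isCommutativeRing)
    renaming (_+_ to _+ᶠ_; _*_ to _*ᶠ_; -_ to -ᶠ_)

  field-ring : CommutativeRing _ _
  field-ring = record { isCommutativeRing = isCommutativeRing }

  open LineIntersections field-ring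
  open WithInverses inverse

  -- (i, j) ↦ a + ξb and (i, j) ↦ a − ξb; their images are A + ξB and A − ξB.
  line coline : Carrier → Fin q → Fin q → Carrier
  line ξ i j = elt i +ᶠ (ξ *ᶠ elt j)
  coline ξ i j = elt i +ᶠ (-ᶠ (ξ *ᶠ elt j))

  energy-coline : ∀ ξ → energy (coline ξ) ≡ energy (line ξ)
  energy-coline ξ = trans (∑⁴-cong reflected) (∑⁴-swap λ i j i′ j′ → W i j i′ j′ * 𝟙[ line ξ i j ≟F line ξ i′ j′ ])
    where
    swap-weight : ∀ x y u v → x * y * (u * v) ≡ x * v * (u * y)
    swap-weight = solve-∀
    reflected : ∀ i j i′ j′ → W i j i′ j′ * 𝟙[ coline ξ i j ≟F coline ξ i′ j′ ]
                            ≡ W i j′ i′ j * 𝟙[ line ξ i j′ ≟F line ξ i′ j ]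
    reflected i j i′ j′ = cong₂ _*_ (swap-weight (a i) (b j) (a i′) (b j′))
      (𝟙-cong (coline ξ i j ≟F coline ξ i′ j′) (line ξ i j′ ≟F line ξ i′ j) reflect reflect⁻¹)

  NonZero? : ∀ l → Dec (elt l ≢ 0#)
  NonZero? l = ¬? (elt l ≟F 0#)

  nonzero-count : ∑[ l < q ] 𝟙[ NonZero? l ] + 1 ≡ q
  nonzero-count = begin
    ∑[ l < q ] 𝟙[ NonZero? l ] + 1
      ≡⟨ cong (∑[ l < q ] 𝟙[ NonZero? l ] +_) (∑-elt 0#) ⟨
    ∑[ l < q ] 𝟙[ NonZero? l ] + ∑[ l < q ] 𝟙[ 0# ≟F elt l ]
      ≡⟨ ∑-distrib-+ (λ l → 𝟙[ NonZero? l ]) (λ l → 𝟙[ 0# ≟F elt l ]) ⟨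
    ∑[ l < q ] (𝟙[ NonZero? l ] + 𝟙[ 0# ≟F elt l ])
      ≡⟨ sum-cong-≗ complementary ⟩
    ∑[ l < q ] 1
      ≡⟨ ∑-const q 1 ⟩
    q * 1
      ≡⟨ *-identityʳ q ⟩
    q ∎
    where
    open ≡-Reasoning
    complementary : ∀ l → 𝟙[ NonZero? l ] + 𝟙[ 0# ≟F elt l ] ≡ 1
    complementary l = trans (cong (𝟙[ NonZero? l ] +_) (𝟙-cong (0# ≟F elt l) (elt l ≟F 0#) sym sym))
                            (𝟙-¬-+ (elt l ≟F 0#))

  Collide? : ∀ i j i′ j′ l → Dec (elt l ≢ 0# × line (elt l) i j ≡ line (elt l) i′ j′)
  Collide? i j i′ j′ l = NonZero? l ×-dec (line (elt l) i j ≟F line (elt l) i′ j′)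

  collisions : Fin q → Fin q → Fin q → Fin q → ℕ
  collisions i j i′ j′ = ∑[ l < q ] 𝟙[ Collide? i j i′ j′ l ]

  collisions-none : ∀ {i j i′ j′} → (∀ l → elt l ≢ 0# → line (elt l) i j ≢ line (elt l) i′ j′) →
    collisions i j i′ j′ ≡ 0
  collisions-none {i} {j} {i′} {j′} never = ∑-zero λ l → 𝟙-no (Collide? i j i′ j′ l) λ (ξ≢0 , e) → never l ξ≢0 e

  collisions≤nonzero : ∀ i j i′ j′ → collisions i j i′ j′ ≤ ∑[ l < q ] 𝟙[ NonZero? l ]
  collisions≤nonzero i j i′ j′ = ∑-mono λ l → 𝟙-×-≤ (NonZero? l) (line (elt l) i j ≟F line (elt l) i′ j′)

  collisions≤1 : ∀ i j i′ j′ → j ≢ j′ → collisions i j i′ j′ ≤ 1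
  collisions≤1 i j i′ j′ j≢j′ = ∑-atMostOne (Collide? i j i′ j′) λ l l′ (_ , e) (_ , e′) →
    elt-injective (meet-unique (j≢j′ ∘ elt-injective) e e′)

  collision-count : ∀ i j i′ j′ →
    collisions i j i′ j′ + 𝟙[ i ≟ᶠ i′ ] + 𝟙[ j ≟ᶠ j′ ] ≤ 𝟙[ i ≟ᶠ i′ ] * 𝟙[ j ≟ᶠ j′ ] * q + 1
  collision-count i j i′ j′ with i ≟ᶠ i′ | j ≟ᶠ j′
  ... | yes refl | yes refl = begin
    collisions i j i j + 1 + 1               ≤⟨ +-monoˡ-≤ 1 (+-monoˡ-≤ 1 (collisions≤nonzero i j i j)) ⟩
    ∑[ l < q ] 𝟙[ NonZero? l ] + 1 + 1       ≡⟨ cong (_+ 1) (trans nonzero-count (sym (+-identityʳ q))) ⟩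
    q + 0 + 1                                ∎
    where open ≤-Reasoning
  ... | yes refl | no j≢j′ = ≤-reflexive (cong (λ c → c + 1 + 0) (collisions-none λ l ξ≢0 e →
    j≢j′ (elt-injective (meet-same-intercept ξ≢0 e))))
  ... | no i≢i′ | yes refl = ≤-reflexive (cong (λ c → c + 0 + 1) (collisions-none λ l _ e →
    i≢i′ (elt-injective (meet-same-slope e))))
  ... | no _ | no j≢j′ = ≤-trans (≤-reflexive (trans (+-identityʳ _) (+-identityʳ _))) (collisions≤1 i j i′ j′ j≢j′)

  total-energy : ℕ
  total-energy = ∑[ l < q ] (𝟙[ NonZero? l ] * energy (line (elt l)))

  total-energy-as-collisions : total-energy ≡ ∑⁴ (λ i j i′ j′ → W i j i′ j′ * collisions i j i′ j′)
  total-energy-as-collisions = begin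
    ∑[ l < q ] (𝟙[ NonZero? l ] * ∑⁴ (λ i j i′ j′ → E l i j i′ j′))
      ≡⟨ sum-cong-≗ (λ l → *-distribˡ-∑⁴ 𝟙[ NonZero? l ] (E l)) ⟩
    ∑[ l < q ] ∑⁴ (λ i j i′ j′ → 𝟙[ NonZero? l ] * E l i j i′ j′)
      ≡⟨ ∑-∑⁴-comm (λ l i j i′ j′ → 𝟙[ NonZero? l ] * E l i j i′ j′) ⟩
    ∑⁴ (λ i j i′ j′ → ∑[ l < q ] (𝟙[ NonZero? l ] * E l i j i′ j′))
      ≡⟨ ∑⁴-cong (λ i j i′ j′ → trans (sum-cong-≗ (collide i j i′ j′))
                                      (sym (*-distribˡ-sum (W i j i′ j′) λ l → 𝟙[ Collide? i j i′ j′ l ]))) ⟩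
    ∑⁴ (λ i j i′ j′ → W i j i′ j′ * collisions i j i′ j′) ∎
    where
    open ≡-Reasoning
    E : Fin q → Fin q → Fin q → Fin q → Fin q → ℕ
    E l i j i′ j′ = W i j i′ j′ * 𝟙[ line (elt l) i j ≟F line (elt l) i′ j′ ]
    swap : ∀ x y z → x * (y * z) ≡ y * (x * z)
    swap = solve-∀
    collide : ∀ i j i′ j′ l → 𝟙[ NonZero? l ] * E l i j i′ j′ ≡ W i j i′ j′ * 𝟙[ Collide? i j i′ j′ l ]
    collide i j i′ j′ l = trans (swap 𝟙[ NonZero? l ] (W i j i′ j′) _)
      (cong (W i j i′ j′ *_) (sym (𝟙-× (NonZero? l) (line (elt l) i j ≟F line (elt l) i′ j′))))

  every same : Fin q → Fin q → ℕ
  every _ _ = 1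
  same i i′ = 𝟙[ i ≟ᶠ i′ ]

  weighted : (Fin q → Fin q → ℕ) → (Fin q → Fin q → ℕ) → Fin q → Fin q → Fin q → Fin q → ℕ
  weighted e e′ i j i′ j′ = W i j i′ j′ * (e i i′ * e′ j j′)

  weighted-count : (e e′ : Fin q → Fin q → ℕ) →
    ∑⁴ (weighted e e′) ≡ ∑² (λ i i′ → a i * a i′ * e i i′) * ∑² (λ j j′ → b j * b j′ * e′ j j′)
  weighted-count e e′ =
    trans (∑⁴-cong λ i j i′ j′ → regroup (a i) (b j) (a i′) (b j′) (e i i′) (e′ j j′))
          (∑⁴-separate (λ i i′ → a i * a i′ * e i i′) (λ j j′ → b j * b j′ * e′ j j′))
    where
    regroup : ∀ x y u v s t → x * y * (u * v) * (s * t) ≡ x * u * s * (y * v * t)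
    regroup = solve-∀

  pairs-every : (u : Fin q → ℕ) → ∑² (λ i i′ → u i * u i′ * every i i′) ≡ ∑[ i < q ] u i * ∑[ i < q ] u i
  pairs-every u = trans (∑²-cong λ i i′ → *-identityʳ (u i * u i′)) (∑²-outer u u)

  pairs-same-a : ∑² (λ i i′ → a i * a i′ * same i i′) ≡ #A
  pairs-same-a = ∑²-diagonal a λ i → 𝟙-idem (i ∈? A)

  pairs-same-b : ∑² (λ j j′ → b j * b j′ * same j j′) ≡ #B
  pairs-same-b = ∑²-diagonal b λ j → 𝟙-idem (j ∈? B)

  total-energy-bound : total-energy + #A * (#B * #B) + (#A * #A) * #B ≤ q * (#A * #B) + (#A * #A) * (#B * #B)
  total-energy-bound = begin
    total-energy + #A * (#B * #B) + (#A * #A) * #B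
      ≡⟨ cong₂ _+_ (cong₂ _+_ total-energy-as-collisions
                              (sym (trans (weighted-count same every) (cong₂ _*_ pairs-same-a (pairs-every b)))))
                   (sym (trans (weighted-count every same) (cong₂ _*_ (pairs-every a) pairs-same-b))) ⟩
    ∑⁴ C + ∑⁴ (weighted same every) + ∑⁴ (weighted every same)
      ≡⟨ trans (∑⁴-distrib-+ (λ i j i′ j′ → C i j i′ j′ + weighted same every i j i′ j′) (weighted every same))
               (cong (_+ ∑⁴ (weighted every same)) (∑⁴-distrib-+ C (weighted same every))) ⟨
    ∑⁴ (λ i j i′ j′ → C i j i′ j′ + weighted same every i j i′ j′ + weighted every same i j i′ j′)
      ≤⟨ ∑⁴-mono pointwise ⟩
    ∑⁴ (λ i j i′ j′ → q * weighted same same i j i′ j′ + weighted every every i j i′ j′)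
      ≡⟨ trans (∑⁴-distrib-+ (λ i j i′ j′ → q * weighted same same i j i′ j′) (weighted every every))
               (cong (_+ ∑⁴ (weighted every every)) (sym (*-distribˡ-∑⁴ q (weighted same same)))) ⟩
    q * ∑⁴ (weighted same same) + ∑⁴ (weighted every every)
      ≡⟨ cong₂ _+_ (cong (q *_) (trans (weighted-count same same) (cong₂ _*_ pairs-same-a pairs-same-b)))
                   (trans (weighted-count every every) (cong₂ _*_ (pairs-every a) (pairs-every b))) ⟩
    q * (#A * #B) + (#A * #A) * (#B * #B) ∎
    where
    open ≤-Reasoning
    C : Fin q → Fin q → Fin q → Fin q → ℕ
    C i j i′ j′ = W i j i′ j′ * collisions i j i′ j′
    factor : ∀ W c d e → W * c + W * (d * 1) + W * (1 * e) ≡ W * (c + d + e)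
    factor = solve-∀
    expand : ∀ W d e q → W * (d * e * q + 1) ≡ q * (W * (d * e)) + W * (1 * 1)
    expand = solve-∀
    pointwise : ∀ i j i′ j′ → C i j i′ j′ + weighted same every i j i′ j′ + weighted every same i j i′ j′
                            ≤ q * weighted same same i j i′ j′ + weighted every every i j i′ j′
    pointwise i j i′ j′ = begin
      C i j i′ j′ + weighted same every i j i′ j′ + weighted every same i j i′ j′
        ≡⟨ factor (W i j i′ j′) (collisions i j i′ j′) (same i i′) (same j j′) ⟩
      W i j i′ j′ * (collisions i j i′ j′ + same i i′ + same j j′)
        ≤⟨ *-monoʳ-≤ (W i j i′ j′) (collision-count i j i′ j′) ⟩
      W i j i′ j′ * (same i i′ * same j j′ * q + 1)
        ≡⟨ expand (W i j i′ j′) (same i i′) (same j j′) q ⟩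
      q * weighted same same i j i′ j′ + weighted every every i j i′ j′ ∎

  some-nonzero : elt (index 1#) ≢ 0#
  some-nonzero e = 0≢1 (trans (sym e) (Inverse.strictlyInverseˡ (FiniteField.enum F) 1#))

  good-dilate : ∃ λ l → elt l ≢ 0# × (q ∸ 1) * energy (line (elt l)) ≤ total-energy
  good-dilate with below-average NonZero? (λ l → energy (line (elt l))) (index 1# , some-nonzero)
  ... | l , ξ≢0 , average = l , ξ≢0 , subst (λ c → c * energy (line (elt l)) ≤ total-energy) nonzero-count′ average
    where
    nonzero-count′ : ∑[ l < q ] 𝟙[ NonZero? l ] ≡ q ∸ 1
    nonzero-count′ = trans (sym (m+n∸n≡m _ 1)) (cong (_∸ 1) nonzero-count)

  1≤q : 1 ≤ q
  1≤q = subst (1 ≤_) nonzero-count (m≤n+m 1 _)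

  1≤#A : Nonempty A → 1 ≤ #A
  1≤#A (i , i∈A) = ≤-trans (≤-reflexive (sym (𝟙-yes (i ∈? A) i∈A))) (term≤∑ a i)

  1≤#B : Nonempty B → 1 ≤ #B
  1≤#B (j , j∈B) = ≤-trans (≤-reflexive (sym (𝟙-yes (j ∈? B) j∈B))) (term≤∑ b j)

open FiniteField using (q; Carrier; 0#; sumset; diffset)

lemma1 : (F : FiniteField) → (A B : Subset (q F)) → Nonempty A → Nonempty B →
    ∃ λ (ξ : Carrier F) → ξ ≢ 0# F ×
    ((∣ A ∣ * ∣ B ∣ * (q F ∸ 1) ≤ ∣ sumset F A ξ B ∣ * ((∣ A ∣ * ∣ B ∣ + q F) ∸ (∣ A ∣ + ∣ B ∣)))
    × (∣ A ∣ * ∣ B ∣ * (q F ∸ 1) ≤ ∣ diffset F A ξ B ∣ * ((∣ A ∣ * ∣ B ∣ + q F) ∸ (∣ A ∣ + ∣ B ∣))))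
lemma1 F A B A≢∅ B≢∅ with Energy.good-dilate F A B
... | l , ξ≢0 , average =
  ξ , ξ≢0 , bound (image (line ξ)) (cauchy-schwarz-image (line ξ))
          , bound (image (coline ξ)) coline-cauchy-schwarz
  where
  open Energy F A B
  ξ : Carrier F
  ξ = FiniteField.elt F l
  coline-cauchy-schwarz : (#A * #B) * (#A * #B) ≤ ∣ image (coline ξ) ∣ * energy (line ξ)
  coline-cauchy-schwarz = subst (λ E → (#A * #B) * (#A * #B) ≤ ∣ image (coline ξ) ∣ * E) (energy-coline ξ)
    (cauchy-schwarz-image (coline ξ))
  bound : ∀ X → (#A * #B) * (#A * #B) ≤ ∣ X ∣ * energy (line ξ) →
    ∣ A ∣ * ∣ B ∣ * (q F ∸ 1) ≤ ∣ X ∣ * ((∣ A ∣ * ∣ B ∣ + q F) ∸ (∣ A ∣ + ∣ B ∣))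
  bound X cs rewrite ∣ A ∣≡∑ | ∣ B ∣≡∑ =
    dilate-bound (#A * #B) ∣ X ∣ (energy (line ξ)) total-energy ((#A * #B + q F) ∸ (#A + #B)) (q F ∸ 1) cs average
      (collision-budget #A #B (q F) total-energy (1≤#A A≢∅) (1≤#B B≢∅) 1≤q total-energy-bound)
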